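{- Let $G$ be a finite graph, $M$ a module of $G$, and $S,S'$ independent sets of $G$ with $|S|=|S'|$. Suppose $M\cap S=\{u\}$, $M\cap S'=\{v\}$, $u\neq v$, and $u$ and $v$ lie in different connected components of $G[M]$. Then $S\leftrightsquigarrow S'$ in $G$ if and only if both (i) $S\leftrightsquigarrow (S'\setminus\{v\})\cup\{u\}$ in $G-v$, and (ii) there is an independent set $T$ of $G-v$ with $T\cap M=\emptyset$ and $S\leftrightsquigarrow T$ in $G-v$.
   Context: Token Sliding ($\mathsf{TS}$): for independent sets $S,S'$ of a graph $H$ with $|S|=|S'|$, write $S\leftrightarrow S'$ (in $H$) if $|S\triangle S'|=2$ and the two vertices of $S\triangle S'$ are adjacent in $H$. Write $S\leftrightsquigarrow S'$ in $H$ if there exist $\ell\ge 0$ and independent sets $S_0=S,\dots,S_\ell=S'$ of $H$ with $S_{i-1}\leftrightarrow S_i$ for all $i$. A module of $G=(V,E)$ is a set $M\subseteq V$ such that every vertex of $V\setminus M$ is adjacent to all or to none of the vertices of $M$. -}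

module Defs where

open import Level using (0ℓ)
open import Data.Nat using (ℕ)
open import Data.Fin using (Fin)
open import Data.Fin.Subset public
  using (Subset; _∈_; _∉_; _⊆_; _∩_; _∪_; _─_; _-_; ⁅_⁆; ∁; ∣_∣)
  renaming (⊥ to ∅; ⊤ to Full)
open import Data.Product using (Σ; _×_; ∃₂)
open import Data.Sum using (_⊎_)
open import Relation.Nullary using (¬_)
open import Relation.Binary using (Decidable)
open import Relation.Binary.PropositionalEquality using (_≡_)
open import Relation.Binary.Construct.Closure.ReflexiveTransitive using (Star)

record Graph (n : ℕ) : Set₁ where
  field
    Adj     : Fin n → Fin n → Set
    adj?    : Decidable Adj
    sym     : ∀ {x y} → Adj x y → Adj y x
    irrefl  : ∀ {x} → ¬ Adj x x
open Graph public

module _ {n : ℕ} (G : Graph n) where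

  Independent : Subset n → Set
  Independent S = ∀ x y → x ∈ S → y ∈ S → ¬ Adj G x y

  IsModule : Subset n → Set
  IsModule M = ∀ w → w ∉ M →
    (∀ x → x ∈ M → Adj G w x) ⊎ (∀ x → x ∈ M → ¬ Adj G w x)

  _△_ : Subset n → Subset n → Subset n
  S △ S' = (S ─ S') ∪ (S' ─ S)

  -- Everything below is relative to the induced subgraph H = G[W]
  -- (W ⊆ V(G)).  Independent sets of G[W] are exactly the independent
  -- sets of G contained in W, and adjacency in G[W] is adjacency in G.
  IndIn : Subset n → Subset n → Set
  IndIn W S = S ⊆ W × Independent S

  TSStep : Subset n → Subset n → Subset n → Set
  TSStep W S S' =
    IndIn W S × IndIn W S' × ∣ S ∣ ≡ ∣ S' ∣ ×
    ∃₂ λ x y → (S △ S') ≡ (⁅ x ⁆ ∪ ⁅ y ⁆) × ∣ S △ S' ∣ ≡ 2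
             × x ∈ W × y ∈ W × Adj G x y

  TSReach : Subset n → Subset n → Subset n → Set
  TSReach W S S' = IndIn W S × IndIn W S' × Star (TSStep W) S S'

  ConnectedIn : Subset n → Fin n → Fin n → Set
  ConnectedIn W u v =
    u ∈ W × v ∈ W × Star (λ a b → a ∈ W × b ∈ W × Adj G a b) u v

module Submission where

-- Let V = V(G) - v and S″ = (S' - v) ∪ {u}.  Since M is a
-- module, a set with at most one token in M can be "collapsed" onto any
-- w ∈ M: keep its tokens outside M and put a single token on w if it had
-- one in M.  Collapsing maps a token-sliding sequence of such sets to a
-- token-sliding sequence (moves inside M disappear, a move into or out of M
-- becomes a move of the token on w).
--   (⇒) Collapsing S ⇝ S' onto u gives S ⇝ S″ avoiding v.  Following the
--   token in M along S ⇝ S': it starts at u and must end at v, outside the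
--   component of u in G[M], so it leaves M at some first set T, and up to T
--   no token ever occupies v.
--   (⇐) S″ ⇝ T in G - v collapses onto v to S' ⇝ T, and S ⇝ T; reverse.

open import Defs hiding (sym)
open import Data.Nat using (ℕ; suc)
open import Data.Nat.Properties using (<-irrefl)
open import Data.Fin using (Fin)
open import Data.Fin.Properties using (_≟_)
open import Data.Fin.Subset using (inside; outside; Nonempty; Empty)
open import Data.Fin.Subset.Properties
  using (⊆-antisym; x∈p∪q⁻; x∈p∪q⁺; p─q⊆p; p─⊥≡p; x∈p∧x∉q⇒x∈p─q; x∈p∧x≢y⇒x∈p-y;
         x∈⁅x⁆; x∈⁅y⁆⇒x≡y; x∉⁅y⁆⇒x≢y; ∣⁅x⁆∣≡1; ⊆⊤; ∈⊤; x∉p⇒x∈∁p; x≢y⇒x∉⁅y⁆;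
         x∈p∩q⁺; x∈p∩q⁻; ∉⊥; Empty-unique; p⊂q⇒∣p∣<∣q∣; drop-there; _∈?_; nonempty?)

open import Data.Vec using (_∷_; here; there)
open import Data.Product using (Σ; _×_; _,_; proj₁; proj₂)
open import Data.Sum using (_⊎_; inj₁; inj₂)
open import Data.Empty using (⊥-elim)
open import Function using (_∘_)
open import Function.Bundles using (_⇔_; mk⇔)
open import Relation.Nullary using (¬_; Dec; yes; no; contradiction)
open import Relation.Binary.PropositionalEquality
  using (_≡_; _≢_; refl; sym; trans; cong; subst; subst₂; module ≡-Reasoning)
open import Relation.Binary.Construct.Closure.ReflexiveTransitive
  using (Star; ε; _◅_; _◅◅_; reverse; map)

private
  variable
    n : ℕ
    x z : Fin n
    p q : Subset n

∈─⇒∉ : ∀ (p q : Subset n) → z ∈ p ─ q → z ∉ q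
∈─⇒∉ (s ∷ p) (outside ∷ q) here = λ ()
∈─⇒∉ (s ∷ p) (t ∷ q) (there z∈) = ∈─⇒∉ p q z∈ ∘ drop-there

∈─⁻ : z ∈ p ─ q → z ∈ p × z ∉ q
∈─⁻ {p = p} {q} z∈ = p─q⊆p p q z∈ , ∈─⇒∉ p q z∈

∉─⇒∈ : z ∉ p ─ q → z ∈ p → z ∈ q
∉─⇒∈ {z = z} {q = q} z∉ z∈p with z ∈? q
... | yes z∈q = z∈q
... | no z∉q = contradiction (x∈p∧x∉q⇒x∈p─q z∈p z∉q) z∉

∈-remove⁻ : z ∈ p - x → z ∈ p × z ≢ x
∈-remove⁻ z∈ with ∈─⁻ z∈
... | z∈p , z∉⁅x⁆ = z∈p , x∉⁅y⁆⇒x≢y z∉⁅x⁆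

card-remove : x ∈ p → ∣ p ∣ ≡ suc ∣ p - x ∣
card-remove {p = inside ∷ p} here = cong (suc ∘ ∣_∣) (sym (p─⊥≡p p))
card-remove {p = inside ∷ p} (there x∈p) = cong suc (card-remove x∈p)
card-remove {p = outside ∷ p} (there x∈p) = card-remove x∈p

readd : x ∈ p → (p - x) ∪ ⁅ x ⁆ ≡ p
readd {x = x} {p = p} x∈p = ⊆-antisym ⊆p p⊆
  where
  ⊆p : (p - x) ∪ ⁅ x ⁆ ⊆ p
  ⊆p z∈ with x∈p∪q⁻ (p - x) ⁅ x ⁆ z∈
  ... | inj₁ z∈p-x = proj₁ (∈-remove⁻ z∈p-x)
  ... | inj₂ z∈⁅x⁆ = subst (_∈ p) (sym (x∈⁅y⁆⇒x≡y x z∈⁅x⁆)) x∈p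
  p⊆ : p ⊆ (p - x) ∪ ⁅ x ⁆
  p⊆ {z} z∈p with z ≟ x
  ... | yes refl = x∈p∪q⁺ (inj₂ (x∈⁅x⁆ x))
  ... | no z≢x = x∈p∪q⁺ (inj₁ (x∈p∧x≢y⇒x∈p-y z∈p z≢x))

pair-card : ∀ {x y : Fin n} → x ≢ y → ∣ ⁅ x ⁆ ∪ ⁅ y ⁆ ∣ ≡ 2
pair-card {x = x} {y} x≢y =
  trans (card-remove (x∈p∪q⁺ {p = ⁅ x ⁆} (inj₂ (x∈⁅x⁆ y))))
        (cong suc (trans (cong ∣_∣ drop-y) (∣⁅x⁆∣≡1 x)))
  where
  drop-y : (⁅ x ⁆ ∪ ⁅ y ⁆) - y ≡ ⁅ x ⁆
  drop-y = ⊆-antisym ⊆x x⊆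
    where
    ⊆x : (⁅ x ⁆ ∪ ⁅ y ⁆) - y ⊆ ⁅ x ⁆
    ⊆x z∈ with ∈-remove⁻ z∈
    ... | z∈pair , z≢y with x∈p∪q⁻ ⁅ x ⁆ ⁅ y ⁆ z∈pair
    ...   | inj₁ z∈⁅x⁆ = z∈⁅x⁆
    ...   | inj₂ z∈⁅y⁆ = contradiction (x∈⁅y⁆⇒x≡y y z∈⁅y⁆) z≢y
    x⊆ : ⁅ x ⁆ ⊆ (⁅ x ⁆ ∪ ⁅ y ⁆) - y
    x⊆ z∈⁅x⁆ with x∈⁅y⁆⇒x≡y x z∈⁅x⁆
    ... | refl = x∈p∧x≢y⇒x∈p-y (x∈p∪q⁺ (inj₁ z∈⁅x⁆)) x≢y

module Moves {n : ℕ} (G : Graph n) where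

  record Move (X Y : Subset n) : Set where
    field
      from to  : Fin n
      from∈    : from ∈ X
      from∉    : from ∉ Y
      to∉      : to ∉ X
      to∈      : to ∈ Y
      keep     : ∀ {z} → z ≢ from → z ≢ to → z ∈ X → z ∈ Y
      keep⁻    : ∀ {z} → z ≢ from → z ≢ to → z ∈ Y → z ∈ X
      adjacent : Adj G from to

    stays : ∀ {z} → z ∈ X → z ≢ from → z ∈ Y
    stays z∈X z≢from = keep z≢from (λ { refl → to∉ z∈X }) z∈X

    stays⁻ : ∀ {z} → z ∈ Y → z ≢ to → z ∈ X
    stays⁻ z∈Y z≢to = keep⁻ (λ { refl → from∉ z∈Y }) z≢to z∈Y

    leaver : ∀ {z} → z ∈ X → z ∉ Y → z ≡ from
    leaver {z} z∈X z∉Y with z ≟ from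
    ... | yes z≡from = z≡from
    ... | no z≢from = contradiction (stays z∈X z≢from) z∉Y

  reverseMove : ∀ {X Y} → Move X Y → Move Y X
  reverseMove m = record
    { from = to ; to = from ; from∈ = to∈ ; from∉ = to∉ ; to∉ = from∉ ; to∈ = from∈
    ; keep = λ z≢to z≢from → keep⁻ z≢from z≢to
    ; keep⁻ = λ z≢to z≢from → keep z≢from z≢to
    ; adjacent = Graph.sym G adjacent }
    where open Move m

  module _ {X Y : Subset n} (m : Move X Y) where
    open Move m

    rest : X - from ⊆ Y - to
    rest z∈ with ∈-remove⁻ z∈
    ... | z∈X , z≢from = x∈p∧x≢y⇒x∈p-y (stays z∈X z≢from) (λ { refl → to∉ z∈X })

    lost : X ─ Y ⊆ ⁅ from ⁆
    lost z∈ with ∈─⁻ z∈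
    ... | z∈X , z∉Y = subst (_∈ ⁅ from ⁆) (sym (leaver z∈X z∉Y)) (x∈⁅x⁆ from)

  moveToStep : ∀ {W X Y} → IndIn G W X → IndIn G W Y → Move X Y → TSStep G W X Y
  moveToStep {W} {X} {Y} IX@(X⊆W , _) IY@(Y⊆W , _) m =
    IX , IY , equal-size , from , to , diff≡ , trans (cong ∣_∣ diff≡) (pair-card from≢to) ,
    X⊆W from∈ , Y⊆W to∈ , adjacent
    where
    open Move m
    from≢to : from ≢ to
    from≢to refl = to∉ from∈
    equal-size : ∣ X ∣ ≡ ∣ Y ∣
    equal-size = trans (card-remove from∈)
      (trans (cong (suc ∘ ∣_∣) (⊆-antisym (rest m) (rest (reverseMove m))))
             (sym (card-remove to∈)))
    diff≡ : (X ─ Y) ∪ (Y ─ X) ≡ ⁅ from ⁆ ∪ ⁅ to ⁆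
    diff≡ = ⊆-antisym ⊆pair pair⊆
      where
      ⊆pair : (X ─ Y) ∪ (Y ─ X) ⊆ ⁅ from ⁆ ∪ ⁅ to ⁆
      ⊆pair z∈ with x∈p∪q⁻ (X ─ Y) (Y ─ X) z∈
      ... | inj₁ z∈X─Y = x∈p∪q⁺ (inj₁ (lost m z∈X─Y))
      ... | inj₂ z∈Y─X = x∈p∪q⁺ (inj₂ (lost (reverseMove m) z∈Y─X))
      pair⊆ : ⁅ from ⁆ ∪ ⁅ to ⁆ ⊆ (X ─ Y) ∪ (Y ─ X)
      pair⊆ z∈ with x∈p∪q⁻ ⁅ from ⁆ ⁅ to ⁆ z∈
      ... | inj₁ z∈⁅from⁆ rewrite x∈⁅y⁆⇒x≡y from z∈⁅from⁆ =
        x∈p∪q⁺ (inj₁ (x∈p∧x∉q⇒x∈p─q from∈ from∉))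
      ... | inj₂ z∈⁅to⁆ rewrite x∈⁅y⁆⇒x≡y to z∈⁅to⁆ =
        x∈p∪q⁺ (inj₂ (x∈p∧x∉q⇒x∈p─q to∈ to∉))

  -- Conversely every token-sliding step is a move: the symmetric difference
  -- {x, y} has exactly one vertex in X, since X and Y have the same size.
  stepToMove : ∀ {W X Y} → TSStep G W X Y → Move X Y
  stepToMove {W} {X} {Y} (_ , _ , |X|≡|Y| , x , y , diff≡ , _ , _ , _ , x~y) =
    orient (side (x∈p∪q⁺ (inj₁ (x∈⁅x⁆ x)))) (side (x∈p∪q⁺ {p = ⁅ x ⁆} (inj₂ (x∈⁅x⁆ y))))
    where
    side : ∀ {z} → z ∈ ⁅ x ⁆ ∪ ⁅ y ⁆ → (z ∈ X × z ∉ Y) ⊎ (z ∈ Y × z ∉ X)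
    side z∈ with x∈p∪q⁻ (X ─ Y) (Y ─ X) (subst (_ ∈_) (sym diff≡) z∈)
    ... | inj₁ z∈X─Y = inj₁ (∈─⁻ z∈X─Y)
    ... | inj₂ z∈Y─X = inj₂ (∈─⁻ z∈Y─X)
    module _ {z : Fin n} (z≢x : z ≢ x) (z≢y : z ≢ y) where
      outside-diff : z ∉ (X ─ Y) ∪ (Y ─ X)
      outside-diff z∈ with x∈p∪q⁻ ⁅ x ⁆ ⁅ y ⁆ (subst (_ ∈_) diff≡ z∈)
      ... | inj₁ z∈⁅x⁆ = z≢x (x∈⁅y⁆⇒x≡y x z∈⁅x⁆)
      ... | inj₂ z∈⁅y⁆ = z≢y (x∈⁅y⁆⇒x≡y y z∈⁅y⁆)
      agree : z ∈ X → z ∈ Y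
      agree = ∉─⇒∈ (outside-diff ∘ x∈p∪q⁺ ∘ inj₁)
      agree⁻ : z ∈ Y → z ∈ X
      agree⁻ = ∉─⇒∈ (outside-diff ∘ x∈p∪q⁺ ∘ inj₂)
    -- If x and y both left (or both arrived), one set would strictly contain the other.
    within : ∀ {A B} → x ∉ B → y ∉ B →
             (∀ {z} → z ≢ x → z ≢ y → z ∈ B → z ∈ A) → B ⊆ A
    within x∉B y∉B B→A {z} z∈B = B→A (λ { refl → x∉B z∈B }) (λ { refl → y∉B z∈B }) z∈B
    orient : (x ∈ X × x ∉ Y) ⊎ (x ∈ Y × x ∉ X) → (y ∈ X × y ∉ Y) ⊎ (y ∈ Y × y ∉ X) → Move X Y
    orient (inj₁ (x∈X , x∉Y)) (inj₂ (y∈Y , y∉X)) = record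
      { from = x ; to = y ; from∈ = x∈X ; from∉ = x∉Y ; to∉ = y∉X ; to∈ = y∈Y
      ; keep = agree ; keep⁻ = agree⁻ ; adjacent = x~y }
    orient (inj₂ (x∈Y , x∉X)) (inj₁ (y∈X , y∉Y)) = record
      { from = y ; to = x ; from∈ = y∈X ; from∉ = y∉Y ; to∉ = x∉X ; to∈ = x∈Y
      ; keep = λ z≢y z≢x → agree z≢x z≢y ; keep⁻ = λ z≢y z≢x → agree⁻ z≢x z≢y
      ; adjacent = Graph.sym G x~y }
    orient (inj₁ (x∈X , x∉Y)) (inj₁ (_ , y∉Y)) =
      ⊥-elim (<-irrefl (sym |X|≡|Y|) (p⊂q⇒∣p∣<∣q∣ (within x∉Y y∉Y agree⁻ , x , x∈X , x∉Y)))
    orient (inj₂ (x∈Y , x∉X)) (inj₂ (_ , y∉X)) =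
      ⊥-elim (<-irrefl |X|≡|Y| (p⊂q⇒∣p∣<∣q∣ (within x∉X y∉X agree , x , x∈Y , x∉X)))

  restrictStep : ∀ {W W' X Y} → TSStep G W X Y → X ⊆ W' → Y ⊆ W' → TSStep G W' X Y
  restrictStep s@((_ , X-ind) , (_ , Y-ind) , _) X⊆W' Y⊆W' =
    moveToStep (X⊆W' , X-ind) (Y⊆W' , Y-ind) (stepToMove s)

  widenStep : ∀ {W X Y} → TSStep G W X Y → TSStep G Full X Y
  widenStep s = restrictStep s ⊆⊤ ⊆⊤

  reverseStep : ∀ {W X Y} → TSStep G W X Y → TSStep G W Y X
  reverseStep s@(IX , IY , _) = moveToStep IY IX (reverseMove (stepToMove s))

module Modules {n : ℕ} (G : Graph n) (M : Subset n) (isModule : IsModule G M) where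
  open Moves G

  transfer : ∀ {z a b} → z ∉ M → a ∈ M → b ∈ M → Adj G z a → Adj G z b
  transfer {z} {a} {b} z∉M a∈M b∈M z~a with isModule z z∉M
  ... | inj₁ adjacent-to-all = adjacent-to-all b b∈M
  ... | inj₂ adjacent-to-none = contradiction z~a (adjacent-to-none a a∈M)

  AtMostOne : Subset n → Set
  AtMostOne X = ∀ {a b} → a ∈ X → b ∈ X → a ∈ M → b ∈ M → a ≡ b

  module _ {X Y : Subset n} (m : Move X Y) where
    open Move m

    -- A token entering M from outside sees all of M, so M held no token before.
    entering-empties : Independent G X → from ∉ M → to ∈ M → Empty (X ∩ M)
    entering-empties X-ind from∉M to∈M (a , a∈X∩M) with x∈p∩q⁻ X M a∈X∩M
    ... | a∈X , a∈M = X-ind from a from∈ a∈X (transfer from∉M to∈M a∈M adjacent)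

    leaving-empties : AtMostOne X → from ∈ M → to ∉ M → Empty (Y ∩ M)
    leaving-empties one from∈M to∉M (a , a∈Y∩M) with x∈p∩q⁻ Y M a∈Y∩M
    ... | a∈Y , a∈M =
      from∉ (subst (_∈ Y) (one (stays⁻ a∈Y λ { refl → to∉M a∈M }) from∈ a∈M from∈M) a∈Y)

    move-atMostOne : Independent G X → AtMostOne X → AtMostOne Y
    move-atMostOne X-ind one a∈Y b∈Y a∈M b∈M with to ∈? M
    ... | no to∉M =
      one (stays⁻ a∈Y λ { refl → to∉M a∈M }) (stays⁻ b∈Y λ { refl → to∉M b∈M }) a∈M b∈M
    ... | yes to∈M = trans (is-to a∈Y a∈M) (sym (is-to b∈Y b∈M))
      where
      is-to : ∀ {c} → c ∈ Y → c ∈ M → c ≡ to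
      is-to {c} c∈Y c∈M with c ≟ to | from ∈? M
      ... | yes c≡to | _ = c≡to
      ... | no c≢to | yes from∈M =
        contradiction (subst (_∈ Y) (one (stays⁻ c∈Y c≢to) from∈ c∈M from∈M) c∈Y) from∉
      ... | no c≢to | no from∉M =
        contradiction (c , x∈p∩q⁺ (stays⁻ c∈Y c≢to , c∈M)) (entering-empties X-ind from∉M to∈M)

  collapse : Fin n → Subset n → Subset n
  collapse w X = (X ─ M) ∪ marker (nonempty? (X ∩ M))
    where
    marker : Dec (Nonempty (X ∩ M)) → Subset n
    marker (yes _) = ⁅ w ⁆
    marker (no _) = ∅

  collapse-occupied : ∀ {w X} → Nonempty (X ∩ M) → collapse w X ≡ (X ─ M) ∪ ⁅ w ⁆
  collapse-occupied {X = X} occupied with nonempty? (X ∩ M)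
  ... | yes _ = refl
  ... | no unoccupied = contradiction occupied unoccupied

  ∈collapse⁻ : ∀ {w X z} → z ∈ collapse w X → (z ∈ X × z ∉ M) ⊎ (z ≡ w × Nonempty (X ∩ M))
  ∈collapse⁻ {w} {X} z∈ with nonempty? (X ∩ M)
  ... | yes occupied with x∈p∪q⁻ (X ─ M) ⁅ w ⁆ z∈
  ...   | inj₁ z∈X─M = inj₁ (∈─⁻ z∈X─M)
  ...   | inj₂ z∈⁅w⁆ = inj₂ (x∈⁅y⁆⇒x≡y w z∈⁅w⁆ , occupied)
  ∈collapse⁻ {w} {X} z∈ | no _ with x∈p∪q⁻ (X ─ M) ∅ z∈
  ...   | inj₁ z∈X─M = inj₁ (∈─⁻ z∈X─M)
  ...   | inj₂ z∈∅ = ⊥-elim (∉⊥ z∈∅)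

  ∈collapse⁺ : ∀ {w X z} → z ∈ X → z ∉ M → z ∈ collapse w X
  ∈collapse⁺ {w} {X} z∈X z∉M with nonempty? (X ∩ M)
  ... | yes _ = x∈p∪q⁺ (inj₁ (x∈p∧x∉q⇒x∈p─q z∈X z∉M))
  ... | no _ = x∈p∪q⁺ (inj₁ (x∈p∧x∉q⇒x∈p─q z∈X z∉M))

  w∈collapse : ∀ {w X} → Nonempty (X ∩ M) → w ∈ collapse w X
  w∈collapse {w} {X} occupied =
    subst (w ∈_) (sym (collapse-occupied occupied)) (x∈p∪q⁺ {p = X ─ M} (inj₂ (x∈⁅x⁆ w)))

  collapse-⊆ : ∀ {w X Y} → (∀ {z} → z ∉ M → z ∈ X → z ∈ Y) →
               (Nonempty (X ∩ M) → Nonempty (Y ∩ M)) → collapse w X ⊆ collapse w Y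
  collapse-⊆ same-outside occupancy z∈ with ∈collapse⁻ z∈
  ... | inj₁ (z∈X , z∉M) = ∈collapse⁺ (same-outside z∉M z∈X) z∉M
  ... | inj₂ (refl , occupied) = w∈collapse (occupancy occupied)

  collapse-atMostOne : ∀ {w X} → AtMostOne (collapse w X)
  collapse-atMostOne a∈ b∈ a∈M b∈M with ∈collapse⁻ a∈ | ∈collapse⁻ b∈
  ... | inj₁ (_ , a∉M) | _ = contradiction a∈M a∉M
  ... | _ | inj₁ (_ , b∉M) = contradiction b∈M b∉M
  ... | inj₂ (refl , _) | inj₂ (refl , _) = refl

  module _ {w : Fin n} (w∈M : w ∈ M) where

    collapse-outside : ∀ {X z} → z ∉ M → z ∈ collapse w X → z ∈ X
    collapse-outside z∉M z∈ with ∈collapse⁻ z∈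
    ... | inj₁ (z∈X , _) = z∈X
    ... | inj₂ (refl , _) = contradiction w∈M z∉M

    -- The token on w is adjacent to a vertex outside M exactly when the
    -- original token in M was, so independence survives.
    collapse-independent : ∀ {X} → Independent G X → Independent G (collapse w X)
    collapse-independent X-ind a b a∈ b∈ a~b with ∈collapse⁻ a∈ | ∈collapse⁻ b∈
    ... | inj₁ (a∈X , _) | inj₁ (b∈X , _) = X-ind a b a∈X b∈X a~b
    ... | inj₁ (a∈X , a∉M) | inj₂ (refl , c , c∈X∩M) =
      X-ind a c a∈X (proj₁ (x∈p∩q⁻ _ M c∈X∩M)) (transfer a∉M w∈M (proj₂ (x∈p∩q⁻ _ M c∈X∩M)) a~b)
    ... | inj₂ (refl , c , c∈X∩M) | inj₁ (b∈X , b∉M) =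
      X-ind b c b∈X (proj₁ (x∈p∩q⁻ _ M c∈X∩M))
        (transfer b∉M w∈M (proj₂ (x∈p∩q⁻ _ M c∈X∩M)) (Graph.sym G a~b))
    ... | inj₂ (refl , _) | inj₂ (refl , _) = Graph.irrefl G a~b

    collapse-indIn : ∀ {W X} → w ∈ W → (∀ {z} → z ∉ M → z ∈ W) →
                     Independent G X → IndIn G W (collapse w X)
    collapse-indIn {W} {X} w∈W outside⊆W X-ind = collapse⊆W , collapse-independent X-ind
      where
      collapse⊆W : collapse w X ⊆ W
      collapse⊆W z∈ with ∈collapse⁻ z∈
      ... | inj₁ (_ , z∉M) = outside⊆W z∉M
      ... | inj₂ (refl , _) = w∈W

    module _ {X Y : Subset n} (m : Move X Y) where
      open Move m

      inside-move : from ∈ M → to ∈ M → collapse w X ≡ collapse w Y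
      inside-move from∈M to∈M = ⊆-antisym
        (collapse-⊆ (λ z∉M z∈X → stays z∈X λ { refl → z∉M from∈M })
                    (λ _ → to , x∈p∩q⁺ (to∈ , to∈M)))
        (collapse-⊆ (λ z∉M z∈Y → stays⁻ z∈Y λ { refl → z∉M to∈M })
                    (λ _ → from , x∈p∩q⁺ (from∈ , from∈M)))

      leaving-move : from ∈ M → to ∉ M → Empty (Y ∩ M) → Move (collapse w X) (collapse w Y)
      leaving-move from∈M to∉M Y-empty = record
        { from = w ; to = to
        ; from∈ = w∈collapse (from , x∈p∩q⁺ (from∈ , from∈M))
        ; from∉ = w∉collapseY
        ; to∉ = to∉ ∘ collapse-outside to∉M
        ; to∈ = ∈collapse⁺ to∈ to∉M
        ; keep = kept
        ; keep⁻ = kept⁻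
        ; adjacent = Graph.sym G (transfer to∉M from∈M w∈M (Graph.sym G adjacent)) }
        where
        w∉collapseY : w ∉ collapse w Y
        w∉collapseY w∈ with ∈collapse⁻ w∈
        ... | inj₁ (_ , w∉M) = w∉M w∈M
        ... | inj₂ (_ , occupied) = Y-empty occupied
        kept : ∀ {z} → z ≢ w → z ≢ to → z ∈ collapse w X → z ∈ collapse w Y
        kept z≢w _ z∈ with ∈collapse⁻ z∈
        ... | inj₁ (z∈X , z∉M) = ∈collapse⁺ (stays z∈X λ { refl → z∉M from∈M }) z∉M
        ... | inj₂ (z≡w , _) = contradiction z≡w z≢w
        kept⁻ : ∀ {z} → z ≢ w → z ≢ to → z ∈ collapse w Y → z ∈ collapse w X
        kept⁻ _ z≢to z∈ with ∈collapse⁻ z∈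
        ... | inj₁ (z∈Y , z∉M) = ∈collapse⁺ (stays⁻ z∈Y z≢to) z∉M
        ... | inj₂ (_ , occupied) = ⊥-elim (Y-empty occupied)

    outside-move : ∀ {X Y} (m : Move X Y) → Move.from m ∉ M → Move.to m ∉ M →
                   Move (collapse w X) (collapse w Y)
    outside-move m from∉M to∉M = record
      { from = from ; to = to
      ; from∈ = ∈collapse⁺ from∈ from∉M
      ; from∉ = from∉ ∘ collapse-outside from∉M
      ; to∉ = to∉ ∘ collapse-outside to∉M
      ; to∈ = ∈collapse⁺ to∈ to∉M
      ; keep = carried m from∉M
      ; keep⁻ = λ z≢from z≢to → carried (reverseMove m) to∉M z≢to z≢from
      ; adjacent = adjacent }
      where
      open Move m
      carried : ∀ {A B} (m : Move A B) → Move.from m ∉ M → ∀ {z} →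
                z ≢ Move.from m → z ≢ Move.to m → z ∈ collapse w A → z ∈ collapse w B
      carried m′ from∉M′ z≢from z≢to z∈ with ∈collapse⁻ z∈
      ... | inj₁ (z∈A , z∉M) = ∈collapse⁺ (Move.keep m′ z≢from z≢to z∈A) z∉M
      ... | inj₂ (refl , c , c∈A∩M) with x∈p∩q⁻ _ M c∈A∩M
      ...   | c∈A , c∈M =
        w∈collapse (c , x∈p∩q⁺ (Move.stays m′ c∈A (λ { refl → from∉M′ c∈M }) , c∈M))

    collapse-move : ∀ {X Y} → Independent G X → AtMostOne X → (m : Move X Y) →
                    collapse w X ≡ collapse w Y ⊎ Move (collapse w X) (collapse w Y)
    collapse-move X-ind one m with Move.from m ∈? M | Move.to m ∈? M
    ... | yes from∈M | yes to∈M = inj₁ (inside-move m from∈M to∈M)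
    ... | yes from∈M | no to∉M =
      inj₂ (leaving-move m from∈M to∉M (leaving-empties m one from∈M to∉M))
    ... | no from∉M | yes to∈M =
      inj₂ (reverseMove (leaving-move (reverseMove m) to∈M from∉M
                          (entering-empties m X-ind from∉M to∈M)))
    ... | no from∉M | no to∉M = inj₂ (outside-move m from∉M to∉M)

    collapse-path : ∀ {W W' X Y} → w ∈ W' → (∀ {z} → z ∉ M → z ∈ W') → AtMostOne X →
                    Star (TSStep G W) X Y → Star (TSStep G W') (collapse w X) (collapse w Y)
    collapse-path w∈W' outside⊆W' one ε = ε
    collapse-path {W} {W'} {X} {Y} w∈W' outside⊆W' one (_◅_ {j = X′} s p) =
      prepend (collapse-move X-ind one m)
              (collapse-path w∈W' outside⊆W' (move-atMostOne m X-ind one) p)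
      where
      m : Move X X′
      m = stepToMove s
      X-ind : Independent G X
      X-ind = proj₂ (proj₁ s)
      X′-ind : Independent G X′
      X′-ind = proj₂ (proj₁ (proj₂ s))
      prepend : collapse w X ≡ collapse w X′ ⊎ Move (collapse w X) (collapse w X′) →
                Star (TSStep G W') (collapse w X′) (collapse w Y) →
                Star (TSStep G W') (collapse w X) (collapse w Y)
      prepend (inj₁ same) rest = subst (λ A → Star (TSStep G W') A _) (sym same) rest
      prepend (inj₂ m′) rest = moveToStep (collapse-indIn w∈W' outside⊆W' X-ind)
                                          (collapse-indIn w∈W' outside⊆W' X′-ind) m′ ◅ rest

  -- Following a reconfiguration sequence whose single token in M starts in a
  -- part of M closed under M-edges (described by P) and must end outside it:
  -- before that token can leave the part, it has to leave M altogether, and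
  -- the prefix up to that moment stays inside any W hosting the part and all
  -- vertices outside M.
  module Escape (P : Fin n → Set)
                (P-closed : ∀ {a b} → P a → a ∈ M → b ∈ M → Adj G a b → P b)
                {W : Subset n} (outside⊆W : ∀ {z} → z ∉ M → z ∈ W)
                (P⊆W : ∀ {z} → z ∈ M → P z → z ∈ W) where

    confined : ∀ {X} → (∀ {z} → z ∈ X → z ∈ M → P z) → X ⊆ W
    confined X-in-P {z} z∈X with z ∈? M
    ... | yes z∈M = P⊆W z∈M (X-in-P z∈X z∈M)
    ... | no z∉M = outside⊆W z∉M

    confined-at : ∀ {X a} → AtMostOne X → a ∈ X → a ∈ M → P a → X ⊆ W
    confined-at one a∈X a∈M Pa = confined λ z∈X z∈M → subst P (one a∈X z∈X a∈M z∈M) Pa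

    Escapes : Subset n → Set
    Escapes X = Σ (Subset n) λ T → IndIn G W T × T ∩ M ≡ ∅ × Star (TSStep G W) X T

    escape : ∀ {W₀ X Y} → Star (TSStep G W₀) X Y → AtMostOne X →
             ∀ {a} → a ∈ X → a ∈ M → P a → (∀ {b} → b ∈ Y → b ∈ M → ¬ P b) → Escapes X
    escape ε one a∈X a∈M Pa stuck = ⊥-elim (stuck a∈X a∈M Pa)
    escape {X = X} (_◅_ {j = X′} s p) one {a} a∈X a∈M Pa stuck = follow (a ≟ from) (to ∈? M)
      where
      m : Move X X′
      m = stepToMove s
      open Move m
      one′ : AtMostOne X′
      one′ = move-atMostOne m (proj₂ (proj₁ s)) one
      X⊆W : X ⊆ W
      X⊆W = confined-at one a∈X a∈M Pa
      via : X′ ⊆ W → Escapes X′ → Escapes X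
      via X′⊆W (T , T-indIn , T∩M≡∅ , path) = T , T-indIn , T∩M≡∅ , restrictStep s X⊆W X′⊆W ◅ path
      follow : Dec (a ≡ from) → Dec (to ∈ M) → Escapes X
      -- the token in M slides along an edge of G[M]: it stays in the part P
      follow (yes a≡from) (yes to∈M) =
        via (confined-at one′ to∈ to∈M Pto) (escape p one′ to∈ to∈M Pto stuck)
        where
        Pto : P to
        Pto = P-closed Pa a∈M to∈M (subst (λ b → Adj G b to) (sym a≡from) adjacent)
      -- the token leaves M: X′ is the set we are looking for
      follow (yes a≡from) (no to∉M) =
        X′ , (X′⊆W , proj₂ (proj₁ (proj₂ s))) , Empty-unique X′-empty , restrictStep s X⊆W X′⊆W ◅ ε
        where
        X′-empty : Empty (X′ ∩ M)
        X′-empty = leaving-empties m one (subst (_∈ M) a≡from a∈M) to∉M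
        X′⊆W : X′ ⊆ W
        X′⊆W = confined λ z∈X′ z∈M → ⊥-elim (X′-empty (_ , x∈p∩q⁺ (z∈X′ , z∈M)))
      -- another token moves: a stays
      follow (no a≢from) _ = via (confined-at one′ a∈X′ a∈M Pa) (escape p one′ a∈X′ a∈M Pa stuck)
        where
        a∈X′ : a ∈ X′
        a∈X′ = stays a∈X a≢from

  module _ {X : Subset n} {a : Fin n} (single : M ∩ X ≡ ⁅ a ⁆) where

    single-member : a ∈ M × a ∈ X
    single-member = x∈p∩q⁻ M X (subst (a ∈_) (sym single) (x∈⁅x⁆ a))

    single-unique : ∀ {z} → z ∈ M → z ∈ X → z ≡ a
    single-unique z∈M z∈X = x∈⁅y⁆⇒x≡y a (subst (_ ∈_) single (x∈p∩q⁺ (z∈M , z∈X)))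

    single-atMostOne : AtMostOne X
    single-atMostOne a∈X b∈X a∈M b∈M = trans (single-unique a∈M a∈X) (sym (single-unique b∈M b∈X))

    collapse-single : ∀ {w} → collapse w X ≡ (X - a) ∪ ⁅ w ⁆
    collapse-single =
      trans (collapse-occupied (a , x∈p∩q⁺ (proj₂ single-member , proj₁ single-member)))
            (cong (_∪ ⁅ _ ⁆) (⊆-antisym drop-M drop-a))
      where
      drop-M : X ─ M ⊆ X - a
      drop-M z∈ with ∈─⁻ z∈
      ... | z∈X , z∉M = x∈p∧x≢y⇒x∈p-y z∈X λ { refl → z∉M (proj₁ single-member) }
      drop-a : X - a ⊆ X ─ M
      drop-a z∈ with ∈-remove⁻ z∈
      ... | z∈X , z≢a = x∈p∧x∉q⇒x∈p─q z∈X λ z∈M → z≢a (single-unique z∈M z∈X)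

  collapse-empty : ∀ {w X} → X ∩ M ≡ ∅ → collapse w X ≡ X
  collapse-empty {w} {X} X∩M≡∅ = ⊆-antisym ⊆X X⊆
    where
    unoccupied : Empty (X ∩ M)
    unoccupied (c , c∈) = ∉⊥ (subst (c ∈_) X∩M≡∅ c∈)
    ⊆X : collapse w X ⊆ X
    ⊆X z∈ with ∈collapse⁻ z∈
    ... | inj₁ (z∈X , _) = z∈X
    ... | inj₂ (_ , occupied) = ⊥-elim (unoccupied occupied)
    X⊆ : X ⊆ collapse w X
    X⊆ {z} z∈X = ∈collapse⁺ z∈X λ z∈M → unoccupied (z , x∈p∩q⁺ (z∈X , z∈M))

  collapse-collapse : ∀ {w w′ X} → w′ ∈ M → collapse w (collapse w′ X) ≡ collapse w X
  collapse-collapse {w} {w′} {X} w′∈M = ⊆-antisym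
    (collapse-⊆ (collapse-outside w′∈M) occupied⇒)
    (collapse-⊆ (λ z∉M z∈X → ∈collapse⁺ z∈X z∉M)
                (λ occupied → w′ , x∈p∩q⁺ (w∈collapse occupied , w′∈M)))
    where
    occupied⇒ : Nonempty (collapse w′ X ∩ M) → Nonempty (X ∩ M)
    occupied⇒ (z , z∈) with x∈p∩q⁻ (collapse w′ X) M z∈
    ... | z∈collapse , z∈M with ∈collapse⁻ z∈collapse
    ...   | inj₁ (_ , z∉M) = contradiction z∈M z∉M
    ...   | inj₂ (_ , occupied) = occupied

module Setting {n : ℕ} (G : Graph n) (M S S' : Subset n) (u v : Fin n)
               (isModule : IsModule G M) (S-ind : Independent G S) (S'-ind : Independent G S')
               (S-single : M ∩ S ≡ ⁅ u ⁆) (S'-single : M ∩ S' ≡ ⁅ v ⁆)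
               (separated : ¬ ConnectedIn G M u v) where
  open Moves G
  open Modules G M isModule

  V : Subset n
  V = ∁ ⁅ v ⁆

  S″ : Subset n
  S″ = (S' - v) ∪ ⁅ u ⁆

  u∈M : u ∈ M
  u∈M = proj₁ (single-member S-single)
  u∈S : u ∈ S
  u∈S = proj₂ (single-member S-single)
  v∈M : v ∈ M
  v∈M = proj₁ (single-member S'-single)
  v∈S' : v ∈ S'
  v∈S' = proj₂ (single-member S'-single)

  ∈V : ∀ {z} → z ≢ v → z ∈ V
  ∈V z≢v = x∉p⇒x∈∁p (x≢y⇒x∉⁅y⁆ z≢v)

  outside⊆V : ∀ {z} → z ∉ M → z ∈ V
  outside⊆V z∉M = ∈V λ { refl → z∉M v∈M }

  reachable-closed : ∀ {a b} → ConnectedIn G M u a → a ∈ M → b ∈ M → Adj G a b →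
                     ConnectedIn G M u b
  reachable-closed (u∈M′ , _ , u⇝a) a∈M b∈M a~b = u∈M′ , b∈M , u⇝a ◅◅ ((a∈M , b∈M , a~b) ◅ ε)

  reachable⊆V : ∀ {z} → z ∈ M → ConnectedIn G M u z → z ∈ V
  reachable⊆V _ u⇝z = ∈V λ { refl → separated u⇝z }

  u∈V : u ∈ V
  u∈V = reachable⊆V u∈M (u∈M , u∈M , ε)

  S'-unreachable : ∀ {b} → b ∈ S' → b ∈ M → ¬ ConnectedIn G M u b
  S'-unreachable b∈S' b∈M u⇝b =
    separated (subst (ConnectedIn G M u) (single-unique S'-single b∈M b∈S') u⇝b)

  collapse-S : collapse u S ≡ S
  collapse-S = trans (collapse-single S-single) (readd u∈S)

  collapse-S' : collapse u S' ≡ S″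
  collapse-S' = collapse-single S'-single

  collapse-S″ : collapse v S″ ≡ S'
  collapse-S″ = begin
    collapse v S″                ≡⟨ cong (collapse v) (sym collapse-S') ⟩
    collapse v (collapse u S')   ≡⟨ collapse-collapse u∈M ⟩
    collapse v S'                ≡⟨ collapse-single S'-single ⟩
    (S' - v) ∪ ⁅ v ⁆             ≡⟨ readd v∈S' ⟩
    S'                           ∎
    where open ≡-Reasoning

  S-in-V : IndIn G V S
  S-in-V = subst (IndIn G V) collapse-S (collapse-indIn u∈M u∈V outside⊆V S-ind)

  S″-in-V : IndIn G V S″
  S″-in-V = subst (IndIn G V) collapse-S' (collapse-indIn u∈M u∈V outside⊆V S'-ind)

  open Escape (ConnectedIn G M u) reachable-closed outside⊆V reachable⊆V

  -- (i): collapsing a sequence S ⇝ S' onto u keeps it away from v.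
  -- (ii): following its token in M, which must end outside the component of u,
  -- yields a set T without tokens in M, reached before v can be touched.
  forward : TSReach G Full S S' →
            TSReach G V S S″ × Σ (Subset n) (λ T → IndIn G V T × T ∩ M ≡ ∅ × TSReach G V S T)
  forward (_ , _ , S⇝S')
    with escape S⇝S' (single-atMostOne S-single) u∈S u∈M (u∈M , u∈M , ε) S'-unreachable
  ... | T , T-in-V , T∩M≡∅ , S⇝T =
    (S-in-V , S″-in-V , S⇝S″) , T , T-in-V , T∩M≡∅ , S-in-V , T-in-V , S⇝T
    where
    S⇝S″ : Star (TSStep G V) S S″
    S⇝S″ = subst₂ (Star (TSStep G V)) collapse-S collapse-S'
             (collapse-path u∈M u∈V outside⊆V (single-atMostOne S-single) S⇝S')

  -- Conversely S″ ⇝ T in G - v collapses onto v to S' ⇝ T in G, and T is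
  -- reachable from S; so S ⇝ T ⇝ S'.
  backward : TSReach G V S S″ × Σ (Subset n) (λ T → IndIn G V T × T ∩ M ≡ ∅ × TSReach G V S T) →
             TSReach G Full S S'
  backward ((_ , _ , S⇝S″) , T , _ , T∩M≡∅ , _ , _ , S⇝T) =
    (⊆⊤ , S-ind) , (⊆⊤ , S'-ind) , map widenStep S⇝T ◅◅ reverse reverseStep S'⇝T
    where
    S″⇝T : Star (TSStep G V) S″ T
    S″⇝T = reverse reverseStep S⇝S″ ◅◅ S⇝T
    S'⇝T : Star (TSStep G Full) S' T
    S'⇝T = subst₂ (Star (TSStep G Full)) collapse-S″ (collapse-empty T∩M≡∅)
             (collapse-path v∈M ∈⊤ (λ _ → ∈⊤) (subst AtMostOne collapse-S' collapse-atMostOne) S″⇝T)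

lemma10 : {n : ℕ} (G : Graph n) (M S S' : Subset n) (u v : Fin n) →
    IsModule G M →
    Independent G S → Independent G S' → ∣ S ∣ ≡ ∣ S' ∣ →
    M ∩ S ≡ ⁅ u ⁆ → M ∩ S' ≡ ⁅ v ⁆ → u ≢ v →
    ¬ ConnectedIn G M u v →
    TSReach G Full S S' ⇔
      (TSReach G (∁ ⁅ v ⁆) S ((S' - v) ∪ ⁅ u ⁆)
        × Σ (Subset n) (λ T → IndIn G (∁ ⁅ v ⁆) T × T ∩ M ≡ ∅ × TSReach G (∁ ⁅ v ⁆) S T))
lemma10 G M S S' u v isModule S-ind S'-ind _ S-single S'-single _ separated =
  mk⇔ forward backward
  where open Setting G M S S' u v isModule S-ind S'-ind S-single S'-single separated
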